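{- Let $G$ be a finite simple connected graph with a closed labeling $V(G)=[n]$ and diameter $h$. Let $0\le N<h$, let $m_{N+1}=\min L_{N+1}$, let $u_s$ be the $s$-th smallest element of $L_N$, and let $b_s$ be the number of edges of $G$ joining $u_s$ to a vertex of $L_{N+1}$. If $b_s>0$, then \[\{v\in L_{N+1}: \{u_s,v\}\in E(G)\}=[m_{N+1},\ m_{N+1}+b_s-1].\]
   Context: A labeling $V(G)=[n]$ is closed if whenever $\{j,i\},\{i,k\}\in E(G)$ with $j\neq k$ and either $j>i<k$ or $j<i>k$, then $\{j,k\}\in E(G)$. For $i\le j$, $[i,j]=\{k\in[n]: i\le k\le j\}$. For a connected graph with $V(G)=[n]$, the $N$-th layer is $L_N=\{i\in[n]: \text{the graph distance from } i \text{ to } 1 \text{ is } N\}$. -}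

module Defs where

open import Data.Nat using (ℕ; zero; suc; _+_; _∸_; _≤_; _<_)
open import Data.Product using (_×_; Σ; ∃; ∃-syntax)
open import Data.Sum using (_⊎_)
open import Data.List using (List; length; lookup)
open import Data.List.Membership.Propositional using (_∈_)
open import Data.List.Relation.Unary.Unique.Propositional using (Unique)
open import Data.List.Relation.Unary.Sorted.TotalOrder using (Sorted)
open import Data.Fin using (Fin; toℕ)
open import Data.Nat.Properties using (≤-totalOrder)
open import Relation.Binary.PropositionalEquality using (_≡_; _≢_)
open import Relation.Nullary using (¬_)
open import Function.Bundles using (_⇔_)

_∈[_,_] : ℕ → ℕ → ℕ → Set
k ∈[ i , j ] = i ≤ k × k ≤ j

record Graph (n : ℕ) : Set₁ where
  field
    E       : ℕ → ℕ → Set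
    E-sym   : ∀ {i j} → E i j → E j i
    E-irr   : ∀ {i} → ¬ E i i
    E-vert  : ∀ {i j} → E i j → i ∈[ 1 , n ] × j ∈[ 1 , n ]
open Graph public

data Walk {n : ℕ} (G : Graph n) : ℕ → ℕ → ℕ → Set where
  here : ∀ {i} → Walk G i i 0
  step : ∀ {i j k l} → E G i j → Walk G j k l → Walk G i k (suc l)

Dist : ∀ {n} → Graph n → ℕ → ℕ → ℕ → Set
Dist G i j d = Walk G i j d × (∀ l → Walk G i j l → d ≤ l)

Connected : ∀ {n} → Graph n → Set
Connected {n} G = ∀ i j → i ∈[ 1 , n ] → j ∈[ 1 , n ] → ∃[ d ] Walk G i j d

Diameter : ∀ {n} → Graph n → ℕ → Set
Diameter {n} G h =
  (∀ i j d → i ∈[ 1 , n ] → j ∈[ 1 , n ] → Dist G i j d → d ≤ h)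
  × (∃[ i ] ∃[ j ] (i ∈[ 1 , n ] × j ∈[ 1 , n ] × Dist G i j h))

Closed : ∀ {n} → Graph n → Set
Closed G = ∀ i j k → E G j i → E G i k → j ≢ k →
  ((i < j × i < k) ⊎ (j < i × k < i)) → E G j k

Layer : ∀ {n} → Graph n → ℕ → ℕ → Set
Layer G N v = Dist G 1 v N

IsMin : (ℕ → Set) → ℕ → Set
IsMin P m = P m × (∀ v → P v → m ≤ v)

SortedEnum : (ℕ → Set) → List ℕ → Set
SortedEnum P xs = Sorted ≤-totalOrder xs × Unique xs × (∀ v → (v ∈ xs ⇔ P v))

HasCard : (ℕ → Set) → ℕ → Set
HasCard P b = Σ (List ℕ) λ xs → Unique xs × (∀ v → (v ∈ xs ⇔ P v)) × length xs ≡ b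

-- In a closed graph a walk can always be shortened to one whose labels are strictly
-- monotone: at a local extremum x - v - p of the labels, closedness supplies the chord
-- x - p. For connected G this gives: consecutive labels are adjacent; an edge {i,j}
-- with i < j forces {i,k} for every i < k < j; and the distance from 1 is
-- non-decreasing in the label. Hence u_s < m_{N+1}, and the neighbours of u_s in
-- L_{N+1} form a set of labels that is downward closed in [m_{N+1}, ∞); a set of b
-- naturals that is downward closed in [m, ∞) is [m, m + b - 1].
module Submission where

open import Level using (Level)
open import Defs
open import Data.Nat using (ℕ; suc; _+_; _∸_; _<_; _>_; _≤_; z≤n; s≤s; s≤s⁻¹; _≟_; _≤?_)
open import Data.Nat.Properties
open import Data.Product using (_×_; _,_; proj₁; proj₂; ∃-syntax)
open import Data.Sum using (_⊎_; inj₁; inj₂; swap; [_,_]′)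
open import Data.List using (List; []; _∷_; length; lookup; applyUpTo)
open import Data.List.Properties using (length-removeAt′; length-applyUpTo)
open import Data.List.Relation.Unary.Any using (here; there; _─_)
import Data.List.Relation.Unary.All as All
open import Data.List.Relation.Unary.AllPairs using (_∷_)
open import Data.List.Relation.Unary.Unique.Propositional using (Unique)
open import Data.List.Relation.Unary.Unique.Propositional.Properties using (applyUpTo⁺₁)
open import Data.List.Relation.Binary.Subset.Propositional using (_⊆_)
open import Data.List.Membership.Propositional using (_∈_)
open import Data.List.Membership.Propositional.Properties
  using (∈-lookup; ∈-applyUpTo⁺; ∈-applyUpTo⁻)
open import Data.List.Membership.DecPropositional _≟_ using (_∈?_)
open import Data.Fin using (Fin)
open import Function using (flip; _∘_)
open import Function.Bundles using (_⇔_; mk⇔; Equivalence)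
open import Relation.Nullary using (yes; no; contradiction)
open import Relation.Binary.Definitions using (tri<; tri≈; tri>)
open import Relation.Binary.PropositionalEquality using (_≡_; _≢_; refl; sym; cong; subst)

private variable
  a : Level
  A : Set a

∈-─⁺ : ∀ {x y} {xs : List A} (y∈xs : y ∈ xs) → x ∈ xs → x ≢ y → x ∈ (xs ─ y∈xs)
∈-─⁺ (here refl) (here refl) x≢y    = contradiction refl x≢y
∈-─⁺ (here refl) (there x∈xs) _     = x∈xs
∈-─⁺ (there _) (here refl) _        = here refl
∈-─⁺ (there y∈xs) (there x∈xs) x≢y = there (∈-─⁺ y∈xs x∈xs x≢y)

Unique-⊆⇒length≤ : ∀ {xs ys : List A} → Unique xs → xs ⊆ ys → length xs ≤ length ys
Unique-⊆⇒length≤ {xs = []} _ _ = z≤n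
Unique-⊆⇒length≤ {xs = x ∷ xs} {ys} (x∉xs ∷ xs-unique) xs⊆ys = begin
  suc (length xs)           ≤⟨ s≤s (Unique-⊆⇒length≤ xs-unique xs⊆ys─x) ⟩
  suc (length (ys ─ x∈ys))  ≡⟨ length-removeAt′ ys _ ⟨
  length ys                 ∎
  where
  open ≤-Reasoning
  x∈ys : x ∈ ys
  x∈ys = xs⊆ys (here refl)
  xs⊆ys─x : xs ⊆ (ys ─ x∈ys)
  xs⊆ys─x y∈xs = ∈-─⁺ x∈ys (xs⊆ys (there y∈xs)) (λ y≡x → All.lookup x∉xs y∈xs (sym y≡x))

interval : ℕ → ℕ → List ℕ
interval m c = applyUpTo (m +_) c

∈-interval⁺ : ∀ {m c x} → m ≤ x → x < m + c → x ∈ interval m c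
∈-interval⁺ {m} {c} m≤x x<m+c = subst (_∈ interval m c) (m+[n∸m]≡n m≤x)
  (∈-applyUpTo⁺ (m +_) (+-cancelˡ-< m _ _ (subst (_< m + c) (sym (m+[n∸m]≡n m≤x)) x<m+c)))

∈-interval⁻ : ∀ {m c x} → x ∈ interval m c → m ≤ x × x < m + c
∈-interval⁻ {m} x∈ with i , i<c , refl ← ∈-applyUpTo⁻ (m +_) x∈ = m≤m+n m i , +-monoʳ-< m i<c

interval-unique : ∀ m c → Unique (interval m c)
interval-unique m c = applyUpTo⁺₁ (m +_) c (λ i<j _ → <⇒≢ (+-monoʳ-< m i<j))

length-interval : ∀ m c → length (interval m c) ≡ c
length-interval m c = length-applyUpTo (m +_) c

<⇔≤∸1 : ∀ {v k} → 0 < k → (v < k ⇔ v ≤ k ∸ 1)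
<⇔≤∸1 {k = suc _} _ = mk⇔ s≤s⁻¹ s≤s

downClosed-card⇒interval : ∀ (P : ℕ → Set) {m b} →
  (∀ {v} → P v → m ≤ v) → (∀ {x w} → P x → m ≤ w → w ≤ x → P w) →
  HasCard P b → 0 < b → ∀ v → P v ⇔ v ∈[ m , m + b ∸ 1 ]
downClosed-card⇒interval P {m} P⇒m≤ P-downClosed (xs , xs-unique , xs⇔P , refl) 0<b v =
  mk⇔ (λ Pv → P⇒m≤ Pv , Equivalence.to v<m+b⇔ (P⇒<m+b Pv))
      (λ (m≤v , v≤) → inRange⇒P m≤v (Equivalence.from v<m+b⇔ v≤))
  where
  v<m+b⇔ : v < m + length xs ⇔ v ≤ m + length xs ∸ 1
  v<m+b⇔ = <⇔≤∸1 (<-≤-trans 0<b (m≤n+m _ m))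

  ∈xs⇒P : ∀ {x} → x ∈ xs → P x
  ∈xs⇒P {x} = Equivalence.to (xs⇔P x)

  P⇒<m+b : P v → v < m + length xs
  P⇒<m+b Pv = begin-strict
    v                   <⟨ n<1+n v ⟩
    suc v               ≡⟨ m+[n∸m]≡n m≤1+v ⟨
    m + (suc v ∸ m)     ≡⟨ cong (m +_) (length-interval m (suc v ∸ m)) ⟨
    m + length (interval m (suc v ∸ m))
                        ≤⟨ +-monoʳ-≤ m (Unique-⊆⇒length≤ (interval-unique m _) [m,v]⊆xs) ⟩
    m + length xs       ∎
    where
    open ≤-Reasoning
    m≤1+v : m ≤ suc v
    m≤1+v = m≤n⇒m≤1+n (P⇒m≤ Pv)
    [m,v]⊆xs : interval m (suc v ∸ m) ⊆ xs
    [m,v]⊆xs {x} x∈ with m≤x , x<m+1+v-m ← ∈-interval⁻ x∈ =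
      Equivalence.from (xs⇔P x)
        (P-downClosed Pv m≤x (s≤s⁻¹ (subst (x <_) (m+[n∸m]≡n m≤1+v) x<m+1+v-m)))

  -- If v ∉ xs then xs ⊆ [m, v), which has fewer than |xs| elements.
  inRange⇒P : m ≤ v → v < m + length xs → P v
  inRange⇒P m≤v v<m+b with v ∈? xs
  ... | yes v∈xs = ∈xs⇒P v∈xs
  ... | no v∉xs = contradiction (<-≤-trans v<m+b m+b≤v) (<-irrefl refl)
    where
    xs⊆[m,v[ : xs ⊆ interval m (v ∸ m)
    xs⊆[m,v[ {x} x∈xs = ∈-interval⁺ (P⇒m≤ (∈xs⇒P x∈xs))
      (subst (x <_) (sym (m+[n∸m]≡n m≤v)) x<v)
      where
      x<v : x < v
      x<v with v ≤? x
      ... | yes v≤x = contradiction (Equivalence.from (xs⇔P v) (P-downClosed (∈xs⇒P x∈xs) m≤v v≤x)) v∉xs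
      ... | no v≰x = ≰⇒> v≰x
    m+b≤v : m + length xs ≤ v
    m+b≤v = subst (_≤ v) (+-comm (length xs) m) (m≤o∸n⇒m+n≤o (length xs) m≤v
      (subst (length xs ≤_) (length-interval m (v ∸ m))
        (Unique-⊆⇒length≤ xs-unique xs⊆[m,v[)))

AtMost : (ℕ → Set) → ℕ → Set
AtMost W l = ∃[ l′ ] (l′ ≤ l × W l′)

AtMost-weaken : ∀ {W : ℕ → Set} {l l′} → l ≤ l′ → AtMost W l → AtMost W l′
AtMost-weaken l≤l′ (k , k≤l , w) = k , ≤-trans k≤l l≤l′ , w

≢⇒<∨> : ∀ {x y} → x ≢ y → x < y ⊎ x > y
≢⇒<∨> {x} {y} x≢y with <-cmp x y
... | tri< x<y _ _ = inj₁ x<y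
... | tri≈ _ x≡y _ = contradiction x≡y x≢y
... | tri> _ _ x>y = inj₂ x>y

_▷_ : ∀ {n} {G : Graph n} {x y z l} → Walk G x y l → E G y z → Walk G x z (suc l)
here      ▷ e = step e here
step e′ w ▷ e = step e′ (w ▷ e)

Walk-target-vertex : ∀ {n} {G : Graph n} {x y l} → Walk G x y (suc l) → y ∈[ 1 , n ]
Walk-target-vertex {G = G} (step e here) = proj₂ (E-vert G e)
Walk-target-vertex (step _ (step e w))   = Walk-target-vertex (step e w)

module _ {n} (G : Graph n) where

  E⇒≢ : ∀ {x y} → E G x y → x ≢ y
  E⇒≢ e refl = E-irr G e

  data Chain (_≺_ : ℕ → ℕ → Set) : ℕ → ℕ → ℕ → Set where
    []   : ∀ {i} → Chain _≺_ i i 0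
    step : ∀ {i j k l} → E G i j → i ≺ j → Chain _≺_ j k l → Chain _≺_ i k (suc l)

  Monotone : ℕ → ℕ → ℕ → Set
  Monotone x y l = Chain _<_ x y l ⊎ Chain _>_ x y l

  ascending⇒≤ : ∀ {i k l} → Chain _<_ i k l → i ≤ k
  ascending⇒≤ []             = ≤-refl
  ascending⇒≤ (step _ i<j c) = ≤-trans (<⇒≤ i<j) (ascending⇒≤ c)

  descending⇒≥ : ∀ {i k l} → Chain _>_ i k l → k ≤ i
  descending⇒≥ []             = ≤-refl
  descending⇒≥ (step _ i>j c) = ≤-trans (descending⇒≥ c) (<⇒≤ i>j)

  module _ (closed : Closed G) where

    module Prepend (_≺_ : ℕ → ℕ → Set)
        (≢⇒≺∨≻ : ∀ {x y} → x ≢ y → x ≺ y ⊎ y ≺ x)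
        (closed-at-≺-min : ∀ {i j k} → E G j i → E G i k → j ≢ k → i ≺ j → i ≺ k → E G j k)
        (along : ∀ {x y l} → Chain _≺_ x y l → Monotone x y l)
        (against : ∀ {x y l} → Chain (flip _≺_) x y l → Monotone x y l) where

      prepend : ∀ {x v y l} → E G x v → Chain _≺_ v y l → AtMost (Monotone x y) (suc l)
      prepend {x} e c with ≢⇒≺∨≻ (E⇒≢ e)
      ... | inj₁ x≺v = _ , ≤-refl , along (step e x≺v c)
      prepend {x} e [] | inj₂ v≺x = _ , ≤-refl , against (step e v≺x [])
      prepend {x} e (step {j = p} e′ v≺p c) | inj₂ v≺x with x ≟ p
      ... | yes refl = _ , m≤n⇒m≤1+n (n≤1+n _) , along c
      ... | no x≢p   = AtMost-weaken (n≤1+n _)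
                         (prepend (closed-at-≺-min e e′ x≢p v≺x v≺p) c)

    module Ascending = Prepend _<_ ≢⇒<∨>
      (λ ej ek j≢k i<j i<k → closed _ _ _ ej ek j≢k (inj₁ (i<j , i<k))) inj₁ inj₂
    module Descending = Prepend _>_ (swap ∘ ≢⇒<∨>)
      (λ ej ek j≢k i>j i>k → closed _ _ _ ej ek j≢k (inj₂ (i>j , i>k))) inj₂ inj₁

    Walk⇒Monotone : ∀ {x y l} → Walk G x y l → AtMost (Monotone x y) l
    Walk⇒Monotone here = 0 , z≤n , inj₁ []
    Walk⇒Monotone (step e w) with Walk⇒Monotone w
    ... | _ , l′≤l , inj₁ asc  = AtMost-weaken (s≤s l′≤l) (Ascending.prepend e asc)
    ... | _ , l′≤l , inj₂ desc = AtMost-weaken (s≤s l′≤l) (Descending.prepend e desc)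

    module _ (connected : Connected G) where

      E-suc : ∀ {x} → 1 ≤ x → suc x ≤ n → E G x (suc x)
      E-suc {x} 1≤x x<n with connected x (suc x) (1≤x , <⇒≤ x<n) (s≤s z≤n , x<n)
      ... | _ , w with Walk⇒Monotone w
      ...   | _ , _ , inj₂ desc = contradiction (descending⇒≥ desc) 1+n≰n
      ...   | _ , _ , inj₁ (step e x<p asc) = subst (E G x) (≤-antisym (ascending⇒≤ asc) x<p) e

      -- Closedness at the top vertex of j — j + 1 — i moves the edge {i, j + 1} down to {i, j}.
      E-between : ∀ {i j k} → E G i j → i < k → k < j → E G i k
      E-between {i} {suc j} {k} i~1+j i<k (s≤s k≤j) =
        [ E-between i~j i<k , (λ { refl → i~j }) ]′ (m≤n⇒m<n∨m≡n k≤j)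
        where
        i<j : i < j
        i<j = <-≤-trans i<k k≤j
        j~1+j : E G j (suc j)
        j~1+j = E-suc (≤-trans (s≤s z≤n) i<j) (proj₂ (proj₂ (E-vert G i~1+j)))
        i~j : E G i j
        i~j = closed _ _ _ i~1+j (E-sym G j~1+j) (<⇒≢ i<j) (inj₂ (m<n⇒m<1+n i<j , n<1+n j))

      ascending⇒Walk-below : ∀ {x y v l} → Chain _<_ x y l → x ≤ v → v ≤ y → AtMost (Walk G x v) l
      ascending⇒Walk-below [] x≤v v≤x with refl ← ≤-antisym x≤v v≤x = 0 , z≤n , here
      ascending⇒Walk-below {x} {v = v} (step {j = p} e x<p c) x≤v v≤y with <-cmp v p
      ... | tri≈ _ refl _ = 1 , s≤s z≤n , step e here
      ... | tri> _ _ p<v  with l′ , l′≤l , w ← ascending⇒Walk-below c (<⇒≤ p<v) v≤y =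
                            suc l′ , s≤s l′≤l , step e w
      ... | tri< v<p _ _  with x ≟ v
      ...   | yes refl = 0 , z≤n , here
      ...   | no x≢v   = 1 , s≤s z≤n , step (E-between e (≤∧≢⇒< x≤v x≢v) v<p) here

      Walk-below : ∀ {x y v l} → Walk G x y l → x ≤ v → v ≤ y → AtMost (Walk G x v) l
      Walk-below w x≤v v≤y with Walk⇒Monotone w
      ... | _ , l′≤l , inj₁ asc = AtMost-weaken l′≤l (ascending⇒Walk-below asc x≤v v≤y)
      ... | _ , _ , inj₂ desc
            with refl ← ≤-antisym x≤v (≤-trans v≤y (descending⇒≥ desc)) = 0 , z≤n , here

      Dist≤Walk-above : ∀ {x v w d l} → Dist G x v d → Walk G x w l → x ≤ v → v ≤ w → d ≤ l
      Dist≤Walk-above (_ , d-least) w x≤v v≤w with l′ , l′≤l , w′ ← Walk-below w x≤v v≤w =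
        ≤-trans (d-least l′ w′) l′≤l

proposition5p2 : ∀ {n} (G : Graph n) → Connected G → Closed G →
    (h N : ℕ) → Diameter G h → N < h →
    (m : ℕ) → IsMin (Layer G (1 + N)) m →
    (us : List ℕ) → SortedEnum (Layer G N) us →
    (s : Fin (length us)) →
    (b : ℕ) → HasCard (λ v → Layer G (1 + N) v × E G (lookup us s) v) b →
    0 < b →
    ∀ v → ((Layer G (1 + N) v × E G (lookup us s) v) ⇔ v ∈[ m , m + b ∸ 1 ])
proposition5p2 G connected closed _ N _ _ m (m∈L , m-least) us (_ , _ , us⇔L) s _ =
  downClosed-card⇒interval _ (λ (v∈L , _) → m-least _ v∈L) neighbours-downClosed
  where
  u : ℕ
  u = lookup us s

  u∈L : Layer G N u
  u∈L = Equivalence.to (us⇔L u) (∈-lookup s)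

  1≤m : 1 ≤ m
  1≤m = proj₁ (Walk-target-vertex (proj₁ m∈L))

  beyond-m⇒long : ∀ {w l} → Walk G 1 w l → m ≤ w → suc N ≤ l
  beyond-m⇒long walk m≤w = Dist≤Walk-above G closed connected m∈L walk 1≤m m≤w

  u<m : u < m
  u<m = ≰⇒> (λ m≤u → 1+n≰n (beyond-m⇒long (proj₁ u∈L) m≤u))

  neighbours-downClosed : ∀ {x w} → Layer G (1 + N) x × E G u x → m ≤ w → w ≤ x →
                          Layer G (1 + N) w × E G u w
  neighbours-downClosed {w = w} (_ , u~x) m≤w w≤x =
    (proj₁ u∈L ▷ u~w , λ _ walk → beyond-m⇒long walk m≤w) , u~w
    where
    u~w : E G u w
    u~w = [ E-between G closed connected u~x (<-≤-trans u<m m≤w) , (λ { refl → u~x }) ]′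
            (m≤n⇒m<n∨m≡n w≤x)
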